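{- Let $T$ be a tree with at least $4$ vertices that is 2-distant (a lobster), and suppose $T$ has a perfect matching $M$ such that $M$ is exactly the set of end edges of $T$. Let $P=v_0,v_1,\dots,v_p$ be a path in $T$ of maximal length among all paths $Q$ in $T$ with the property that every vertex of $T$ is at distance at most $2$ from some vertex of $Q$. Then: (i) $\deg(v_0)=1$, and hence $v_0v_1\in M$; (ii) $\deg(v_1)=2$; (iii) every edge of $P$ other than $v_0v_1$ and $v_{p-1}v_p$ does not belong to $M$; (iv) every vertex of $P$ other than $v_0,v_1,v_{p-1},v_p$ is matched under $M$ with an end vertex of $T$ that does not lie on $P$.
   Context: A tree $T$ is 2-distant (a lobster) if it contains a path $P$ such that every vertex of $T$ is at distance at most $2$ from a vertex of $P$. An end edge of $T$ is an edge incident to a vertex of degree $1$ (an end vertex). -}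

module Defs where

open import Data.Nat using (ℕ; zero; suc; _≤_; _<_)
open import Data.Fin using (Fin)
open import Data.Bool using (Bool; true; false)
open import Data.List using (length; filterᵇ; allFin)
open import Data.Product using (Σ; ∃; _×_; _,_)
open import Data.Sum using (_⊎_)
open import Relation.Nullary using (¬_)
open import Relation.Binary.PropositionalEquality using (_≡_)

record Graph (n : ℕ) : Set where
  field
    adj     : Fin n → Fin n → Bool
    adj-sym : ∀ x y → adj x y ≡ adj y x
    irrefl  : ∀ x → adj x x ≡ false
open Graph public

module _ {n : ℕ} (G : Graph n) where

  data Walk : ℕ → Fin n → Fin n → Set where
    nil  : ∀ {x} → Walk zero x x
    cons : ∀ {k x y z} → adj G x y ≡ true → Walk k y z → Walk (suc k) x z

  DistLe : ℕ → Fin n → Fin n → Set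
  DistLe k x y = ∃ λ j → j ≤ k × Walk j x y

  deg : Fin n → ℕ
  deg v = length (filterᵇ (adj G v) (allFin n))

  -- A path v 0, v 1, …, v p with p edges (values of v beyond p are irrelevant):
  -- consecutive vertices adjacent, all vertices distinct.
  IsPath : (p : ℕ) → (ℕ → Fin n) → Set
  IsPath p v = (∀ i → i < p → adj G (v i) (v (suc i)) ≡ true)
             × (∀ i j → i ≤ p → j ≤ p → v i ≡ v j → i ≡ j)

  Connected : Set
  Connected = ∀ x y → ∃ λ k → Walk k x y

  Acyclic : Set
  Acyclic = ¬ (Σ ℕ λ p → Σ (ℕ → Fin n) λ v →
                2 ≤ p × IsPath p v × adj G (v p) (v 0) ≡ true)

  IsTree : Set
  IsTree = Connected × Acyclic

  Dominating2 : (p : ℕ) → (ℕ → Fin n) → Set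
  Dominating2 p v = ∀ x → ∃ λ i → i ≤ p × DistLe 2 x (v i)

  Is2Distant : Set
  Is2Distant = IsTree × (Σ ℕ λ p → Σ (ℕ → Fin n) λ v → IsPath p v × Dominating2 p v)

  MaxDominatingPath : (p : ℕ) → (ℕ → Fin n) → Set
  MaxDominatingPath p v = IsPath p v × Dominating2 p v
    × (∀ q w → IsPath q w → Dominating2 q w → q ≤ p)

  IsPerfectMatching : (Fin n → Fin n → Bool) → Set
  IsPerfectMatching M = (∀ x y → M x y ≡ true → adj G x y ≡ true)
    × (∀ x y → M x y ≡ M y x)
    × (∀ x → ∃ λ y → M x y ≡ true × (∀ z → M x z ≡ true → z ≡ y))

  IsEndEdge : Fin n → Fin n → Set
  IsEndEdge x y = adj G x y ≡ true × (deg x ≡ 1 ⊎ deg y ≡ 1)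

  EqualsEndEdges : (Fin n → Fin n → Bool) → Set
  EqualsEndEdges M = ∀ x y → (M x y ≡ true → IsEndEdge x y) × (IsEndEdge x y → M x y ≡ true)

-- Maximality of P forbids two modifications that would produce a longer
-- 2-dominating path: prepending a vertex outside P to v₀, and replacing v₀
-- (a leaf, so everything near v₀ is near v₁) by a pendant path w, ℓ hanging
-- off v₁ outside P. The first shows that every neighbour of v₀ lies on P, so
-- v₀ is a leaf next to v₁. For the second, let w be a neighbour of v₁ off P
-- and ℓ its partner in M: w cannot be a leaf (v₁ is already matched to v₀),
-- so ℓ is a leaf, hence off P as well, and the replacement applies. So all
-- neighbours of v₀ and v₁ lie on P; were p ≤ 1, P would then span the tree,
-- which has at least three vertices. Acyclicity leaves v₀, v₂ as the only
-- neighbours of v₁. Interior vertices of P have two neighbours on P, so they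
-- are not leaves; since M consists of end edges, an edge of M at an interior
-- vertex goes to a leaf, which cannot be on P.
module Submission where

open import Defs
open import Data.Nat using (ℕ; zero; suc; _+_; _∸_; _≤_; _<_; z≤n; s≤s; s≤s⁻¹; _≤?_)
open import Data.Nat.Properties
open import Data.Fin using (Fin)
open import Data.Fin.Properties using () renaming (_≟_ to _≟ᶠ_)
open import Data.Bool using (Bool; true; false; T?)
open import Data.Bool.Properties using (T-≡; ¬-not)
open import Data.Empty using (⊥; ⊥-elim)
open import Data.Sum using (_⊎_; inj₁; inj₂; [_,_])
open import Data.Product using (∃; _×_; _,_; proj₁; proj₂; uncurry)
open import Data.List using (List; []; _∷_; length; map; upTo; allFin; filterᵇ)
open import Data.List.Properties using (length-removeAt′; length-map; length-upTo; length-tabulate)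
open import Data.List.Membership.Propositional using (_∈_; _─_)
open import Data.List.Membership.Propositional.Properties
  using (∈-filter⁺; ∈-filter⁻; ∈-allFin; ∈-map⁺; ∈-upTo⁺)
open import Data.List.Relation.Unary.Any using (here; there; index)
open import Data.List.Relation.Unary.All using ([]; _∷_) renaming (lookup to All-lookup)
open import Data.List.Relation.Binary.Subset.Propositional using (_⊆_)
open import Data.List.Relation.Unary.AllPairs using ([]; _∷_)
open import Data.List.Relation.Unary.Unique.Propositional using (Unique)
open import Data.List.Relation.Unary.Unique.Propositional.Properties using (filter⁺; allFin⁺)
open import Function using (_∘_; Equivalence)
open import Relation.Nullary using (¬_; Dec; yes; no)
import Relation.Nullary.Decidable as Dec
open import Relation.Binary using (tri<; tri≈; tri>)
open import Relation.Binary.PropositionalEquality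
  using (_≡_; _≢_; refl; sym; trans; cong; subst; ≢-sym)

module _ {A : Set} where

  ∈-─⁺ : ∀ {x z : A} {ys} (x∈ys : x ∈ ys) → z ∈ ys → z ≢ x → z ∈ ys ─ x∈ys
  ∈-─⁺ (here refl) (here refl) z≢x = ⊥-elim (z≢x refl)
  ∈-─⁺ (here refl) (there z∈ys) _ = z∈ys
  ∈-─⁺ (there _) (here refl) _ = here refl
  ∈-─⁺ (there x∈ys) (there z∈ys) z≢x = there (∈-─⁺ x∈ys z∈ys z≢x)

  Unique-⊆⇒length≤ : ∀ {xs ys : List A} → Unique xs → xs ⊆ ys → length xs ≤ length ys
  Unique-⊆⇒length≤ {[]} _ _ = z≤n
  Unique-⊆⇒length≤ {x ∷ xs} {ys} (x≢xs ∷ xs-unique) xs⊆ys = begin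
    suc (length xs)          ≤⟨ s≤s (Unique-⊆⇒length≤ xs-unique xs⊆ys─x) ⟩
    suc (length (ys ─ x∈ys)) ≡⟨ length-removeAt′ ys (index x∈ys) ⟨
    length ys                ∎
    where
    open ≤-Reasoning
    x∈ys : x ∈ ys
    x∈ys = xs⊆ys (here refl)
    xs⊆ys─x : xs ⊆ ys ─ x∈ys
    xs⊆ys─x z∈xs = ∈-─⁺ x∈ys (xs⊆ys (there z∈xs)) (≢-sym (All-lookup x≢xs z∈xs))

_◂_ : {A : Set} → A → (ℕ → A) → ℕ → A
(y ◂ v) zero = y
(y ◂ v) (suc i) = v i

module _ {n : ℕ} (G : Graph n) where

  adj-sym′ : ∀ {x y} → adj G x y ≡ true → adj G y x ≡ true
  adj-sym′ {x} {y} x~y = trans (adj-sym G y x) x~y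

  adj⇒≢ : ∀ {x y} → adj G x y ≡ true → x ≢ y
  adj⇒≢ {x} x~y refl with trans (sym x~y) (irrefl G x)
  ... | ()

  neighbours : Fin n → List (Fin n)
  neighbours x = filterᵇ (adj G x) (allFin n)

  ∈-neighbours⁺ : ∀ {x y} → adj G x y ≡ true → y ∈ neighbours x
  ∈-neighbours⁺ {x} {y} x~y = ∈-filter⁺ (T? ∘ adj G x) (∈-allFin y) (Equivalence.from T-≡ x~y)

  ∈-neighbours⁻ : ∀ {x y} → y ∈ neighbours x → adj G x y ≡ true
  ∈-neighbours⁻ {x} y∈ = Equivalence.to T-≡ (proj₂ (∈-filter⁻ (T? ∘ adj G x) {xs = allFin n} y∈))

  length≤deg : ∀ {x ys} → Unique ys → (∀ {y} → y ∈ ys → adj G x y ≡ true) → length ys ≤ deg G x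
  length≤deg ys-unique ys~x = Unique-⊆⇒length≤ ys-unique (∈-neighbours⁺ ∘ ys~x)

  deg≤length : ∀ {x ys} → (∀ {y} → adj G x y ≡ true → y ∈ ys) → deg G x ≤ length ys
  deg≤length {x} x~⊆ys =
    Unique-⊆⇒length≤ (filter⁺ (T? ∘ adj G x) (allFin⁺ n)) (x~⊆ys ∘ ∈-neighbours⁻)

  two-neighbours⇒2≤deg : ∀ {x a b} → adj G x a ≡ true → adj G x b ≡ true → a ≢ b → 2 ≤ deg G x
  two-neighbours⇒2≤deg {x} {a} {b} x~a x~b a≢b = length≤deg ((a≢b ∷ []) ∷ [] ∷ []) neighbour
    where
    neighbour : ∀ {y} → y ∈ a ∷ b ∷ [] → adj G x y ≡ true
    neighbour (here refl) = x~a
    neighbour (there (here refl)) = x~b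

  deg≡1⇒unique-neighbour : ∀ {x a b} → deg G x ≡ 1 → adj G x a ≡ true → adj G x b ≡ true → a ≡ b
  deg≡1⇒unique-neighbour {a = a} {b} deg≡1 x~a x~b with a ≟ᶠ b
  ... | yes a≡b = a≡b
  ... | no a≢b = ⊥-elim (1+n≰n (subst (2 ≤_) deg≡1 (two-neighbours⇒2≤deg x~a x~b a≢b)))

  unique-neighbour⇒deg≡1 : ∀ {x a} → adj G x a ≡ true → (∀ y → adj G x y ≡ true → y ≡ a) →
                           deg G x ≡ 1
  unique-neighbour⇒deg≡1 {a = a} x~a only-a =
    ≤-antisym (deg≤length {ys = a ∷ []} (λ x~y → here (only-a _ x~y)))
              (length≤deg ([] ∷ []) λ { (here refl) → x~a })

  two-neighbours⇒deg≡2 : ∀ {x a b} → adj G x a ≡ true → adj G x b ≡ true → a ≢ b →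
                         (∀ y → adj G x y ≡ true → y ≡ a ⊎ y ≡ b) → deg G x ≡ 2
  two-neighbours⇒deg≡2 {x} {a} {b} x~a x~b a≢b only-ab =
    ≤-antisym (deg≤length in-ab) (two-neighbours⇒2≤deg x~a x~b a≢b)
    where
    in-ab : ∀ {y} → adj G x y ≡ true → y ∈ a ∷ b ∷ []
    in-ab x~y with only-ab _ x~y
    ... | inj₁ refl = here refl
    ... | inj₂ refl = there (here refl)

  Walk-closed : {S : Fin n → Set} → (∀ {a b} → S a → adj G a b ≡ true → S b) →
                ∀ {k x y} → Walk G k x y → S x → S y
  Walk-closed closed nil Sx = Sx
  Walk-closed closed (cons x~y walk) Sx = Walk-closed closed walk (closed Sx x~y)

  Walk-unsnoc : ∀ {k x z} → Walk G (suc k) x z → ∃ λ y → Walk G k x y × adj G y z ≡ true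
  Walk-unsnoc (cons x~z nil) = _ , nil , x~z
  Walk-unsnoc (cons x~y walk@(cons _ _)) with Walk-unsnoc walk
  ... | y , walk′ , y~z = y , cons x~y walk′ , y~z

  -- A walk into a leaf a passes through its neighbour b just before.
  DistLe-leaf : ∀ {k x a b} → deg G a ≡ 1 → adj G a b ≡ true →
                DistLe G (suc k) x a → DistLe G (suc k) x b
  DistLe-leaf _ a~b (zero , _ , nil) = 1 , s≤s z≤n , cons a~b nil
  DistLe-leaf {x = x} deg≡1 a~b (suc j , j<k , walk) with Walk-unsnoc walk
  ... | y , walk′ , y~a =
    j , <⇒≤ j<k , subst (Walk G j x) (deg≡1⇒unique-neighbour deg≡1 (adj-sym′ y~a) a~b) walk′

  OnPath : ℕ → (ℕ → Fin n) → Fin n → Set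
  OnPath p v y = ∃ λ j → j ≤ p × v j ≡ y

  onPath? : ∀ p v y → Dec (OnPath p v y)
  onPath? p v y = Dec.map′ (λ (j , j<p+1 , e) → j , s≤s⁻¹ j<p+1 , e)
                           (λ (j , j≤p , e) → j , s≤s j≤p , e)
                           (anyUpTo? (λ j → v j ≟ᶠ y) (suc p))

  spanning-path⇒n≤ : ∀ {p v} → (∀ y → OnPath p v y) → n ≤ suc p
  spanning-path⇒n≤ {p} {v} spanning = begin
    n                             ≡⟨ length-tabulate (λ i → i) ⟨
    length (allFin n)             ≤⟨ Unique-⊆⇒length≤ (allFin⁺ n) (λ {y} _ → on-path y) ⟩
    length (map v (upTo (suc p))) ≡⟨ length-map v (upTo (suc p)) ⟩
    length (upTo (suc p))         ≡⟨ length-upTo (suc p) ⟩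
    suc p                         ∎
    where
    open ≤-Reasoning
    on-path : ∀ y → y ∈ map v (upTo (suc p))
    on-path y with spanning y
    ... | j , j≤p , refl = ∈-map⁺ v (∈-upTo⁺ (s≤s j≤p))

  closed-path⇒spanning : ∀ {p v} → Connected G →
                         (∀ {j y} → j ≤ p → adj G (v j) y ≡ true → OnPath p v y) →
                         ∀ y → OnPath p v y
  closed-path⇒spanning {v = v} connected closed y =
    Walk-closed closed′ (proj₂ (connected (v 0) y)) (0 , z≤n , refl)
    where
    closed′ : ∀ {a b} → OnPath _ v a → adj G a b ≡ true → OnPath _ v b
    closed′ (j , j≤p , refl) = closed j≤p

  IsPath-segment : ∀ {p v} → IsPath G p v → ∀ i {d} → i + d ≤ p → IsPath G d (λ k → v (i + k))
  IsPath-segment {p} {v} (adjacent , injective) i {d} i+d≤p = adjacent′ , injective′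
    where
    bound : ∀ {k} → k ≤ d → i + k ≤ p
    bound k≤d = ≤-trans (+-monoʳ-≤ i k≤d) i+d≤p
    adjacent′ : ∀ k → k < d → adj G (v (i + k)) (v (i + suc k)) ≡ true
    adjacent′ k k<d rewrite +-suc i k = adjacent (i + k) (≤-trans (+-monoʳ-< i k<d) i+d≤p)
    injective′ : ∀ k l → k ≤ d → l ≤ d → v (i + k) ≡ v (i + l) → k ≡ l
    injective′ k l k≤d l≤d eq =
      +-cancelˡ-≡ i k l (injective (i + k) (i + l) (bound k≤d) (bound l≤d) eq)

  IsPath-◂ : ∀ {p v y} → IsPath G p v → adj G y (v 0) ≡ true → ¬ OnPath p v y →
             IsPath G (suc p) (y ◂ v)
  IsPath-◂ {p} {v} {y} (adjacent , injective) y~v₀ y∉P = adjacent′ , injective′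
    where
    adjacent′ : ∀ i → i < suc p → adj G ((y ◂ v) i) ((y ◂ v) (suc i)) ≡ true
    adjacent′ zero _ = y~v₀
    adjacent′ (suc i) i<p = adjacent i (s≤s⁻¹ i<p)
    injective′ : ∀ i j → i ≤ suc p → j ≤ suc p → (y ◂ v) i ≡ (y ◂ v) j → i ≡ j
    injective′ zero zero _ _ _ = refl
    injective′ zero (suc j) _ j≤p eq = ⊥-elim (y∉P (j , s≤s⁻¹ j≤p , sym eq))
    injective′ (suc i) zero i≤p _ eq = ⊥-elim (y∉P (i , s≤s⁻¹ i≤p , eq))
    injective′ (suc i) (suc j) i≤p j≤p eq = cong suc (injective i j (s≤s⁻¹ i≤p) (s≤s⁻¹ j≤p) eq)

  Dominating2-◂ : ∀ {p v y} → Dominating2 G p v → Dominating2 G (suc p) (y ◂ v)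
  Dominating2-◂ dominating x with dominating x
  ... | i , i≤p , near = suc i , s≤s i≤p , near

  Dominating2-tail : ∀ {q v} → deg G (v 0) ≡ 1 → adj G (v 0) (v 1) ≡ true →
                     Dominating2 G (suc q) v → Dominating2 G q (v ∘ suc)
  Dominating2-tail deg≡1 v₀~v₁ dominating x with dominating x
  ... | zero , _ , near = 0 , z≤n , DistLe-leaf deg≡1 v₀~v₁ near
  ... | suc i , i<q , near = i , s≤s⁻¹ i<q , near

  replace-leaf : ∀ {p v w ℓ} → 1 ≤ p → IsPath G p v → Dominating2 G p v → deg G (v 0) ≡ 1 →
                 adj G (v 1) w ≡ true → adj G w ℓ ≡ true → ¬ OnPath p v w → ¬ OnPath p v ℓ →
                 IsPath G (suc p) (ℓ ◂ (w ◂ (v ∘ suc)))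
                 × Dominating2 G (suc p) (ℓ ◂ (w ◂ (v ∘ suc)))
  replace-leaf {suc q} {v} {w} {ℓ} _ path dominating deg≡1 v₁~w w~ℓ w∉P ℓ∉P =
    IsPath-◂ (IsPath-◂ (IsPath-segment path 1 ≤-refl) (adj-sym′ v₁~w) w∉tail)
             (adj-sym′ w~ℓ) ℓ∉w◂tail ,
    Dominating2-◂ (Dominating2-◂ (Dominating2-tail deg≡1 (proj₁ path 0 (s≤s z≤n)) dominating))
    where
    w∉tail : ¬ OnPath q (v ∘ suc) w
    w∉tail (j , j≤q , e) = w∉P (suc j , s≤s j≤q , e)
    ℓ∉w◂tail : ¬ OnPath (suc q) (w ◂ (v ∘ suc)) ℓ
    ℓ∉w◂tail (zero , _ , w≡ℓ) = adj⇒≢ w~ℓ w≡ℓ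
    ℓ∉w◂tail (suc j , j≤q , e) = ℓ∉P (suc j , j≤q , e)

  interior-deg≢1 : ∀ {p v j} → IsPath G p v → 1 ≤ j → j < p → deg G (v j) ≢ 1
  interior-deg≢1 {j = suc k} (adjacent , injective) _ j<p deg≡1
    with injective k (suc (suc k)) (≤-trans (n≤1+n k) (<⇒≤ j<p)) j<p
           (deg≡1⇒unique-neighbour deg≡1 (adj-sym′ (adjacent k (<⇒≤ j<p))) (adjacent (suc k) j<p))
  ... | ()

  leaf-on-path⇒neighbour-on-path : ∀ {p v ℓ w} → IsPath G p v → 1 ≤ p → OnPath p v ℓ →
                                   deg G ℓ ≡ 1 → adj G ℓ w ≡ true → OnPath p v w
  leaf-on-path⇒neighbour-on-path (adjacent , _) 1≤p (zero , _ , refl) deg≡1 ℓ~w =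
    1 , 1≤p , deg≡1⇒unique-neighbour deg≡1 (adjacent 0 1≤p) ℓ~w
  leaf-on-path⇒neighbour-on-path (adjacent , _) _ (suc k , k<p , refl) deg≡1 ℓ~w =
    k , <⇒≤ k<p , deg≡1⇒unique-neighbour deg≡1 (adj-sym′ (adjacent k k<p)) ℓ~w

  no-chord : ∀ {p v i j} → Acyclic G → IsPath G p v → suc i < j → j ≤ p →
             ¬ adj G (v j) (v i) ≡ true
  no-chord {p} {v} {i} {j} acyclic path i+1<j j≤p vⱼ~vᵢ =
    acyclic (j ∸ i , (λ k → v (i + k)) , 2≤j∸i , IsPath-segment path i i+[j∸i]≤p , closing)
    where
    i≤j : i ≤ j
    i≤j = ≤-trans (n≤1+n i) (<⇒≤ i+1<j)
    2≤j∸i : 2 ≤ j ∸ i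
    2≤j∸i = subst (_≤ j ∸ i) (m+n∸n≡m 2 i) (∸-monoˡ-≤ i i+1<j)
    i+[j∸i]≤p : i + (j ∸ i) ≤ p
    i+[j∸i]≤p = subst (_≤ p) (sym (m+[n∸m]≡n i≤j)) j≤p
    closing : adj G (v (i + (j ∸ i))) (v (i + 0)) ≡ true
    closing rewrite m+[n∸m]≡n i≤j | +-identityʳ i = vⱼ~vᵢ

  path-adjacent : ∀ {p v i j} → Acyclic G → IsPath G p v → i ≤ p → j ≤ p →
                  adj G (v i) (v j) ≡ true → j ≡ suc i ⊎ i ≡ suc j
  path-adjacent {i = i} {j} acyclic path i≤p j≤p vᵢ~vⱼ with <-cmp j (suc i) | <-cmp i (suc j)
  ... | tri≈ _ j≡i+1 _ | _ = inj₁ j≡i+1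
  ... | _ | tri≈ _ i≡j+1 _ = inj₂ i≡j+1
  ... | tri> _ _ i+1<j | _ = ⊥-elim (no-chord acyclic path i+1<j j≤p (adj-sym′ vᵢ~vⱼ))
  ... | _ | tri> _ _ j+1<i = ⊥-elim (no-chord acyclic path j+1<i i≤p vᵢ~vⱼ)
  ... | tri< j<i+1 _ _ | tri< i<j+1 _ _ =
    ⊥-elim (adj⇒≢ vᵢ~vⱼ (cong _ (≤-antisym (s≤s⁻¹ i<j+1) (s≤s⁻¹ j<i+1))))

  leaf-next-to-interior-off-path : ∀ {p v i u} → Acyclic G → IsPath G p v → 2 ≤ i → suc i < p →
                                   adj G (v i) u ≡ true → deg G u ≡ 1 → ∀ j → j ≤ p → v j ≢ u
  leaf-next-to-interior-off-path acyclic path 2≤i i+1<p vᵢ~u deg≡1 j j≤p refl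
    with path-adjacent acyclic path (≤-trans (n≤1+n _) (<⇒≤ i+1<p)) j≤p vᵢ~u
  ... | inj₁ refl = interior-deg≢1 path (s≤s z≤n) i+1<p deg≡1
  ... | inj₂ refl = interior-deg≢1 path (s≤s⁻¹ 2≤i) (≤-trans (n≤1+n _) (<⇒≤ i+1<p)) deg≡1

module MaximalDominatingPath {n} (G : Graph n) (2≤n : 2 ≤ n) (connected : Connected G)
  (acyclic : Acyclic G) {p : ℕ} {v : ℕ → Fin n} (max : MaxDominatingPath G p v) where

  path : IsPath G p v
  path = proj₁ max

  dominating : Dominating2 G p v
  dominating = proj₁ (proj₂ max)

  longest : ∀ q w → IsPath G q w → Dominating2 G q w → q ≤ p
  longest = proj₂ (proj₂ max)

  v₀-neighbour-on-path : ∀ {y} → adj G (v 0) y ≡ true → OnPath G p v y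
  v₀-neighbour-on-path {y} v₀~y with onPath? G p v y
  ... | yes y∈P = y∈P
  ... | no y∉P = ⊥-elim (1+n≰n (longest (suc p) (y ◂ v)
                   (IsPath-◂ G path (adj-sym′ G v₀~y) y∉P) (Dominating2-◂ G dominating)))

  1≤p : 1 ≤ p
  1≤p with 1 ≤? p
  ... | yes 1≤p = 1≤p
  ... | no 1≰p = ⊥-elim (<⇒≱ 2≤n (≤-trans n≤p+1 p<1))
    where
    p<1 : p < 1
    p<1 = ≰⇒> 1≰p
    closed : ∀ {j y} → j ≤ p → adj G (v j) y ≡ true → OnPath G p v y
    closed {zero} _ = v₀-neighbour-on-path
    closed {suc _} j≤p = ⊥-elim (n≮0 (≤-trans j≤p (s≤s⁻¹ p<1)))
    n≤p+1 : n ≤ suc p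
    n≤p+1 = spanning-path⇒n≤ G (closed-path⇒spanning G connected closed)

  v₀-neighbour : ∀ {y} → adj G (v 0) y ≡ true → y ≡ v 1
  v₀-neighbour v₀~y with v₀-neighbour-on-path v₀~y
  ... | j , j≤p , refl with path-adjacent G acyclic path z≤n j≤p v₀~y
  ... | inj₁ refl = refl

  deg-v₀≡1 : deg G (v 0) ≡ 1
  deg-v₀≡1 = unique-neighbour⇒deg≡1 G (proj₁ path 0 1≤p) (λ _ → v₀-neighbour)

  no-pendant-at-v₁ : ∀ {w ℓ} → adj G (v 1) w ≡ true → adj G w ℓ ≡ true →
                     ¬ OnPath G p v w → ¬ OnPath G p v ℓ → ⊥
  no-pendant-at-v₁ v₁~w w~ℓ w∉P ℓ∉P =
    1+n≰n (uncurry (longest (suc p) _)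
      (replace-leaf G 1≤p path dominating deg-v₀≡1 v₁~w w~ℓ w∉P ℓ∉P))

module EndEdgeMatching {n} (G : Graph n) (M : Fin n → Fin n → Bool) (3≤n : 3 ≤ n)
  (connected : Connected G) (acyclic : Acyclic G)
  (matching : IsPerfectMatching G M) (ends : EqualsEndEdges G M)
  {p : ℕ} {v : ℕ → Fin n} (max : MaxDominatingPath G p v) where

  open MaximalDominatingPath G (<⇒≤ 3≤n) connected acyclic max public

  matched⇒end : ∀ {x y} → M x y ≡ true → deg G x ≡ 1 ⊎ deg G y ≡ 1
  matched⇒end {x} {y} x-y = proj₂ (proj₁ (ends x y) x-y)

  end⇒matched : ∀ {x y} → adj G x y ≡ true → deg G x ≡ 1 → M x y ≡ true
  end⇒matched {x} {y} x~y deg≡1 = proj₂ (ends x y) (x~y , inj₁ deg≡1)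

  matched-sym : ∀ {x y} → M x y ≡ true → M y x ≡ true
  matched-sym {x} {y} x-y = trans (proj₁ (proj₂ matching) y x) x-y

  partner-unique : ∀ {x y z} → M x y ≡ true → M x z ≡ true → y ≡ z
  partner-unique {x} {y} {z} x-y x-z with proj₂ (proj₂ matching) x
  ... | _ , _ , unique = trans (unique y x-y) (sym (unique z x-z))

  v₀-v₁-matched : M (v 0) (v 1) ≡ true
  v₀-v₁-matched = end⇒matched (proj₁ path 0 1≤p) deg-v₀≡1

  v₁-neighbour-on-path : ∀ {w} → adj G (v 1) w ≡ true → OnPath G p v w
  v₁-neighbour-on-path {w} v₁~w with onPath? G p v w
  ... | yes w∈P = w∈P
  ... | no w∉P with proj₂ (proj₂ matching) w
  ... | ℓ , w-ℓ , _ with matched⇒end w-ℓ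
  ... | inj₁ deg-w≡1 = ⊥-elim (w∉P (0 , z≤n , partner-unique (matched-sym v₀-v₁-matched) v₁-w))
    where
    v₁-w : M (v 1) w ≡ true
    v₁-w = matched-sym (end⇒matched (adj-sym′ G v₁~w) deg-w≡1)
  ... | inj₂ deg-ℓ≡1 = ⊥-elim (no-pendant-at-v₁ v₁~w w~ℓ w∉P (w∉P ∘ ℓ∈P⇒w∈P))
    where
    w~ℓ : adj G w ℓ ≡ true
    w~ℓ = proj₁ matching w ℓ w-ℓ
    ℓ∈P⇒w∈P : OnPath G p v ℓ → OnPath G p v w
    ℓ∈P⇒w∈P ℓ∈P = leaf-on-path⇒neighbour-on-path G path 1≤p ℓ∈P deg-ℓ≡1 (adj-sym′ G w~ℓ)

  2≤p : 2 ≤ p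
  2≤p with 2 ≤? p
  ... | yes 2≤p = 2≤p
  ... | no 2≰p = ⊥-elim (<⇒≱ 3≤n (≤-trans n≤p+1 p<2))
    where
    p<2 : p < 2
    p<2 = ≰⇒> 2≰p
    closed : ∀ {j y} → j ≤ p → adj G (v j) y ≡ true → OnPath G p v y
    closed {zero} _ = v₀-neighbour-on-path
    closed {suc zero} _ = v₁-neighbour-on-path
    closed {suc (suc _)} j≤p = ⊥-elim (n≮0 (s≤s⁻¹ (≤-trans j≤p (s≤s⁻¹ p<2))))
    n≤p+1 : n ≤ suc p
    n≤p+1 = spanning-path⇒n≤ G (closed-path⇒spanning G connected closed)

  deg-v₁≡2 : deg G (v 1) ≡ 2
  deg-v₁≡2 =
    two-neighbours⇒deg≡2 G (adj-sym′ G (proj₁ path 0 1≤p)) (proj₁ path 1 2≤p) v₀≢v₂ only-v₀-v₂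
    where
    v₀≢v₂ : v 0 ≢ v 2
    v₀≢v₂ v₀≡v₂ with proj₂ path 0 2 z≤n 2≤p v₀≡v₂
    ... | ()
    only-v₀-v₂ : ∀ y → adj G (v 1) y ≡ true → y ≡ v 0 ⊎ y ≡ v 2
    only-v₀-v₂ y v₁~y with v₁-neighbour-on-path v₁~y
    ... | j , j≤p , refl with path-adjacent G acyclic path 1≤p j≤p v₁~y
    ... | inj₁ refl = inj₂ refl
    ... | inj₂ refl = inj₁ refl

  interior-edge-unmatched : ∀ {i} → 1 ≤ i → suc i < p → M (v i) (v (suc i)) ≡ false
  interior-edge-unmatched 1≤i i+1<p = ¬-not λ vᵢ-vᵢ₊₁ →
    [ interior-deg≢1 G path 1≤i (≤-trans (n≤1+n _) i+1<p) , interior-deg≢1 G path (s≤s z≤n) i+1<p ]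
      (matched⇒end vᵢ-vᵢ₊₁)

  interior-matched-to-leaf : ∀ {i} → 2 ≤ i → suc i < p →
    ∃ λ u → M (v i) u ≡ true × deg G u ≡ 1 × (∀ j → j ≤ p → v j ≢ u)
  interior-matched-to-leaf {i} 2≤i i+1<p with proj₂ (proj₂ matching) (v i)
  ... | u , vᵢ-u , _ with matched⇒end vᵢ-u
  ... | inj₁ deg-vᵢ≡1 =
    ⊥-elim (interior-deg≢1 G path (<⇒≤ 2≤i) (≤-trans (n≤1+n _) i+1<p) deg-vᵢ≡1)
  ... | inj₂ deg-u≡1 = u , vᵢ-u , deg-u≡1 ,
    leaf-next-to-interior-off-path G acyclic path 2≤i i+1<p (proj₁ matching _ _ vᵢ-u) deg-u≡1

lemma3 : ∀ {n} (G : Graph n) (M : Fin n → Fin n → Bool) (p : ℕ) (v : ℕ → Fin n) →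
    4 ≤ n → Is2Distant G → IsPerfectMatching G M → EqualsEndEdges G M →
    MaxDominatingPath G p v →
    (1 ≤ p × deg G (v 0) ≡ 1 × M (v 0) (v 1) ≡ true)
    × deg G (v 1) ≡ 2
    × (∀ i → 1 ≤ i → i + 2 ≤ p → M (v i) (v (suc i)) ≡ false)
    × (∀ i → 2 ≤ i → i + 2 ≤ p →
         ∃ λ u → M (v i) u ≡ true × deg G u ≡ 1 × (∀ j → j ≤ p → v j ≢ u))
lemma3 G M p v 4≤n ((connected , acyclic) , _) matching ends max =
  (1≤p , deg-v₀≡1 , v₀-v₁-matched) , deg-v₁≡2 ,
  (λ i 1≤i i+2≤p → interior-edge-unmatched 1≤i (i+1<p i+2≤p)) ,
  (λ i 2≤i i+2≤p → interior-matched-to-leaf 2≤i (i+1<p i+2≤p))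
  where
  open EndEdgeMatching G M (<⇒≤ 4≤n) connected acyclic matching ends max
  i+1<p : ∀ {i} → i + 2 ≤ p → suc i < p
  i+1<p {i} = subst (_≤ p) (+-comm i 2)
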